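{- For $n\geq 1$, $a_n(213;213) = F_n$, where $F_n$ is the $n$-th Fibonacci number.
   Context: Fibonacci numbers: $F_1=F_2=1$, $F_n=F_{n-1}+F_{n-2}$. $\mathcal{S}_n$ is the set of permutations of $[n]=\{1,\dots,n\}$, written in one-line notation $\pi=\pi_1\pi_2\cdots\pi_n$ with $\pi_i=\pi(i)$. A permutation is cyclic if it consists of exactly one $n$-cycle. For a cyclic $\pi$, its standard cycle notation is $C(\pi)=(c_1,c_2,\dots,c_n)$ with $c_1=1$ and $c_i=\pi_{c_{i-1}}$ for $2\le i\le n$. A sequence of distinct integers $w_1\cdots w_m$ contains a pattern $\sigma\in\mathcal{S}_k$ if there are indices $i_1<\dots<i_k$ with $w_{i_1}\cdots w_{i_k}$ in the same relative order as $\sigma_1\cdots\sigma_k$; otherwise it avoids $\sigma$. For $\sigma,\tau\in\mathcal{S}_3$, $\mathcal{A}_n(\sigma;\tau)$ is the set of cyclic permutations $\pi\in\mathcal{S}_n$ whose one-line notation avoids $\sigma$ and whose cycle notation $C(\pi)$ (as the sequence $c_1c_2\cdots c_n$) avoids $\tau$; $a_n(\sigma;\tau)=|\mathcal{A}_n(\sigma;\tau)|$. -}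

module Defs where

open import Data.Nat using (ℕ; zero; suc; _+_; _<ᵇ_)
open import Data.Bool using (Bool; true; false; _∧_; _∨_; not; if_then_else_)
open import Data.Fin using (Fin; toℕ) renaming (zero to fzero; suc to fsuc)
open import Data.Vec using (Vec; []; _∷_; lookup; toList)
open import Data.List using (List; []; _∷_; length; filter; map; concatMap; allFin; zip)
open import Data.Bool.ListAction using (and; or)
open import Data.Bool.Properties using (T?)

fib : ℕ → ℕ
fib zero = zero
fib (suc zero) = suc zero
fib (suc (suc n)) = fib (suc n) + fib n

-- A map [n] → [n] in one-line notation is a vector of length n with entries
-- in Fin n (entry i is π(i+1) - 1; we use 0-based labels, which does not affect
-- relative order).
allVecs : (k n : ℕ) → List (Vec (Fin n) k)
allVecs zero n = [] ∷ []
allVecs (suc k) n = concatMap (λ x → map (x ∷_) (allVecs k n)) (allFin n)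

_==_ : ℕ → ℕ → Bool
zero == zero = true
zero == suc _ = false
suc _ == zero = false
suc m == suc n = m == n

distinct : List ℕ → Bool
distinct [] = true
distinct (x ∷ xs) = and (map (λ y → not (x == y)) xs) ∧ distinct xs

oneLine : ∀ {n} → Vec (Fin n) n → List ℕ
oneLine v = map toℕ (toList v)

isPerm : ∀ {n} → Vec (Fin n) n → Bool
isPerm v = distinct (oneLine v)

orbit : ∀ {n} → Vec (Fin n) n → ℕ → Fin n → List (Fin n)
orbit v zero x = []
orbit v (suc k) x = x ∷ orbit v k (lookup v x)

-- standard cycle notation C(π) = (c_1, ..., c_n) with c_1 = 1 (label 0 here)
cycleNotation : ∀ {n} → Vec (Fin n) n → List ℕ
cycleNotation {zero} v = []
cycleNotation {suc m} v = map toℕ (orbit v (suc m) fzero)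

-- a permutation is cyclic (one n-cycle) iff the orbit of 1 has n distinct
-- elements, i.e. c_1, ..., c_n are distinct
isCyclic : ∀ {n} → Vec (Fin n) n → Bool
isCyclic v = isPerm v ∧ distinct (cycleNotation v)

subseqs : ℕ → List ℕ → List (List ℕ)
subseqs zero xs = [] ∷ []
subseqs (suc k) [] = []
subseqs (suc k) (x ∷ xs) = map (x ∷_) (subseqs k xs) Data.List.++ subseqs (suc k) xs

sameOrder : List ℕ → List ℕ → Bool
sameOrder s t = and (map (λ p → and (map (λ q → eqB (Pr.proj₁ p <ᵇ Pr.proj₁ q) (Pr.proj₂ p <ᵇ Pr.proj₂ q)) st)) st)
  where
  import Data.Product as Pr
  st = zip s t
  eqB : Bool → Bool → Bool
  eqB true b = b
  eqB false b = not b

contains : List ℕ → List ℕ → Bool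
contains σ w = or (map (λ s → sameOrder s σ) (subseqs (length σ) w))

avoids : List ℕ → List ℕ → Bool
avoids σ w = not (contains σ w)

p213 : List ℕ
p213 = 2 ∷ 1 ∷ 3 ∷ []

𝒜 : (n : ℕ) → List ℕ → List ℕ → List (Vec (Fin n) n)
𝒜 n σ τ = filter (λ v → T? (isCyclic v ∧ avoids σ (oneLine v) ∧ avoids τ (cycleNotation v))) (allVecs n n)

a : (n : ℕ) → List ℕ → List ℕ → ℕ
a n σ τ = length (𝒜 n σ τ)

-- For n ≥ 3 a member of 𝒜_n(213;213) has one of three shapes: π 0 = 1 and π (n-1) = 0;
-- π 0 = n-1 and π (n-1) = 1; or π 0 = n-1, π 1 = 0 and π (n-1) ≠ 1. In every other
-- case a 213 appears either in π or in its cycle notation. Each shape arises from a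
-- smaller member by inserting one or two entries: deleting them and closing up the
-- labels gives a member of size n-1, n-2 or n-1, whose cycle notation is that of π with
-- the same entries deleted, so both avoidance conditions pass back and forth. In the
-- first shape the smaller member cannot start with its maximum, since the cycle of π
-- would then close after three steps, so it is the rotation; in the third it must start
-- with its maximum. Writing T_n for the members starting with n-1 when n ≥ 3, and
-- T_2 = ∅, this gives |𝒜_n| = 1 + |T_n| and |T_n| = |𝒜_{n-2}| + |T_{n-1}|.

module Submission where

open import Defs
open import Data.Bool using (true; false; T; not; _∧_)
open import Data.Bool.Properties using (T-∧; T-≡; T?)
open import Data.Empty using (⊥; ⊥-elim)
open import Data.List using (List; []; _∷_; _++_; [_]; map; length; iterate; upTo; initLast; _∷ʳ′_; concatMap; cartesianProductWith; allFin)
open import Data.List.Properties using (length-iterate; length-applyUpTo; length-++-sucʳ; length-map; length-++; map-++; map-∘; map-id-local; map-injective; ∷-injectiveˡ; ∷-injectiveʳ; ∷ʳ-injectiveˡ)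
open import Data.List.Membership.Propositional using (_∈_; _∉_; find; lose)
open import Data.List.Membership.Propositional.Properties using (∈-map⁺; ∈-map⁻; ∈-++⁺ˡ; ∈-++⁺ʳ; ∈-++⁻; ∈-∃++; ∈-upTo⁺; ∈-allFin; ∈-filter⁺; ∈-filter⁻; ∈-cartesianProductWith⁺)
open import Data.List.Relation.Binary.Sublist.Propositional using (_⊆_; []; _∷_; _∷ʳ_; minimum; ⊆-refl; ⊆-trans)
import Data.List.Relation.Binary.Sublist.Propositional.Properties as Sublist
open import Data.List.Relation.Unary.All as All using (All; []; _∷_)
import Data.List.Relation.Unary.All.Properties as All
open import Data.List.Relation.Unary.Any using (Any; here; there)
import Data.List.Relation.Unary.Any.Properties as Any
open import Data.List.Relation.Unary.AllPairs using ([]; _∷_)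
import Data.List.Relation.Unary.AllPairs as AllPairs
open import Data.List.Relation.Unary.Unique.Propositional using (Unique)
import Data.List.Relation.Unary.Unique.Propositional.Properties as Unique
open import Data.Nat using (ℕ; zero; suc; pred; _+_; >-nonZero; ≢-nonZero; _<_; _≤_; _≥_; _<ᵇ_; z≤n; s≤s; s≤s⁻¹; s<s⁻¹)
open import Data.Nat.Properties
open import Data.Nat.GeneralisedArithmetic using (fold)
open import Data.List.Membership.DecPropositional _≟_ using (_∈?_)
open import Data.Product using (∃-syntax; _×_; _,_; proj₁; proj₂)
open import Data.Sum using (_⊎_; inj₁; inj₂)
import Data.Sum
open import Data.Unit using (⊤; tt)
open import Data.Fin using (Fin; toℕ; fromℕ<) renaming (zero to fzero; suc to fsuc)
open import Data.Fin.Properties using (toℕ-injective; toℕ<n; toℕ-fromℕ<)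
open import Data.Vec using (Vec; lookup; toList) renaming ([] to []ᵛ; _∷_ to _∷ᵛ_)
import Data.Vec.Properties as Vec
open import Function using (_∘_; _$_; _⇔_; Equivalence; mk⇔)
open import Relation.Nullary using (¬_; contradiction; yes; no; Dec)
open import Relation.Binary.Definitions using (tri<; tri≈; tri>)
open import Relation.Binary.PropositionalEquality hiding ([_])

-- Entries past the end read as 0.
nth : List ℕ → ℕ → ℕ
nth []       _       = 0
nth (x ∷ xs) zero    = x
nth (x ∷ xs) (suc i) = nth xs i

nth-∈ : ∀ xs {i} → i < length xs → nth xs i ∈ xs
nth-∈ (x ∷ xs) {zero}  _   = here refl
nth-∈ (x ∷ xs) {suc i} i<l = there (nth-∈ xs (s<s⁻¹ i<l))

∈⇒nth : ∀ {xs y} → y ∈ xs → ∃[ i ] (i < length xs × nth xs i ≡ y)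
∈⇒nth (here refl) = 0 , s≤s z≤n , refl
∈⇒nth (there y∈xs) = let i , i<l , eq = ∈⇒nth y∈xs in suc i , s≤s i<l , eq

All-nth : ∀ {P : ℕ → Set} {xs i} → All P xs → i < length xs → P (nth xs i)
All-nth {xs = xs} all i<l = All.lookup all (nth-∈ xs i<l)

nth-injective : ∀ {xs i j} → Unique xs → i < length xs → j < length xs → nth xs i ≡ nth xs j → i ≡ j
nth-injective {_ ∷ xs} {zero}  {zero}  _             _   _   _  = refl
nth-injective {_ ∷ xs} {zero}  {suc j} (fresh ∷ _)   _   j<l eq = contradiction eq (All-nth fresh (s<s⁻¹ j<l))
nth-injective {_ ∷ xs} {suc i} {zero}  (fresh ∷ _)   i<l _   eq = contradiction (sym eq) (All-nth fresh (s<s⁻¹ i<l))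
nth-injective {_ ∷ xs} {suc i} {suc j} (_ ∷ uniq)    i<l j<l eq = cong suc (nth-injective uniq (s<s⁻¹ i<l) (s<s⁻¹ j<l) eq)

nth-map : ∀ (f : ℕ → ℕ) xs {i} → i < length xs → nth (map f xs) i ≡ f (nth xs i)
nth-map f (x ∷ xs) {zero}  _   = refl
nth-map f (x ∷ xs) {suc i} i<l = nth-map f xs (s<s⁻¹ i<l)

nth-++ˡ : ∀ xs ys {i} → i < length xs → nth (xs ++ ys) i ≡ nth xs i
nth-++ˡ (x ∷ xs) ys {zero}  _   = refl
nth-++ˡ (x ∷ xs) ys {suc i} i<l = nth-++ˡ xs ys (s<s⁻¹ i<l)

nth-++-length : ∀ xs {y ys} → nth (xs ++ y ∷ ys) (length xs) ≡ y
nth-++-length []       = refl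
nth-++-length (x ∷ xs) = nth-++-length xs

length-∷ʳ : ∀ {A : Set} (xs : List A) {y} → length (xs ++ [ y ]) ≡ suc (length xs)
length-∷ʳ []       = refl
length-∷ʳ (x ∷ xs) = cong suc (length-∷ʳ xs)

Unique-head : ∀ {A : Set} {x : A} {xs} → Unique (x ∷ xs) → x ∉ xs
Unique-head = All.All¬⇒¬Any ∘ AllPairs.head

Unique-∷ʳ⁻ : ∀ {A : Set} xs {y : A} → Unique (xs ++ [ y ]) → Unique xs × y ∉ xs
Unique-∷ʳ⁻ []       _              = [] , λ ()
Unique-∷ʳ⁻ (x ∷ xs) (fresh ∷ uniq) =
  let uxs , y∉xs = Unique-∷ʳ⁻ xs uniq
  in All.++⁻ˡ xs fresh ∷ uxs , λ { (here refl) → All.head (All.++⁻ʳ xs fresh) refl ; (there y∈xs) → y∉xs y∈xs }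

Unique-∷ʳ⁺ : ∀ {A : Set} {xs} {y : A} → Unique xs → y ∉ xs → Unique (xs ++ [ y ])
Unique-∷ʳ⁺ {xs = []}     _              _   = [] ∷ []
Unique-∷ʳ⁺ {xs = x ∷ xs} (fresh ∷ uniq) y∉ =
  All.++⁺ fresh ((λ { refl → y∉ (here refl) }) ∷ []) ∷ Unique-∷ʳ⁺ uniq (y∉ ∘ there)

Unique⇒length≤ : ∀ {A : Set} {xs ys : List A} → Unique xs → (∀ {z} → z ∈ xs → z ∈ ys) → length xs ≤ length ys
Unique⇒length≤ {xs = []}     _              _  = z≤n
Unique⇒length≤ {xs = x ∷ xs} (x∉xs ∷ uniq) xs⊆ys with ys₁ , ys₂ , refl ← ∈-∃++ (xs⊆ys (here refl)) =
  ≤-trans (s≤s (Unique⇒length≤ uniq xs⊆ys₁++ys₂)) (≤-reflexive (sym (length-++-sucʳ ys₁ x ys₂)))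
  where
  xs⊆ys₁++ys₂ : ∀ {z} → z ∈ xs → z ∈ ys₁ ++ ys₂
  xs⊆ys₁++ys₂ z∈xs with ∈-++⁻ ys₁ (xs⊆ys (there z∈xs))
  ... | inj₁ z∈ys₁         = ∈-++⁺ˡ z∈ys₁
  ... | inj₂ (here refl)   = contradiction refl (All.lookup x∉xs z∈xs)
  ... | inj₂ (there z∈ys₂) = ∈-++⁺ʳ ys₁ z∈ys₂

Unique⇒length≡ : ∀ {A : Set} {xs ys : List A} → Unique xs → Unique ys → (∀ {z} → z ∈ xs ⇔ z ∈ ys) →
                 length xs ≡ length ys
Unique⇒length≡ uxs uys same =
  ≤-antisym (Unique⇒length≤ uxs (Equivalence.to same)) (Unique⇒length≤ uys (Equivalence.from same))

Unique-bounded⇒∈ : ∀ {n xs y} → Unique xs → All (_< n) xs → length xs ≡ n → y < n → y ∈ xs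
Unique-bounded⇒∈ {n} {xs} {y} uniq bounded refl y<n with y ∈? xs
... | yes y∈xs = y∈xs
... | no  y∉xs = contradiction (≤-trans (Unique⇒length≤ (All.¬Any⇒All¬ xs y∉xs ∷ uniq) y∷xs⊆upTo)
                                        (≤-reflexive (length-applyUpTo _ (length xs))))
                               (n≮n (length xs))
  where
  y∷xs⊆upTo : ∀ {z} → z ∈ y ∷ xs → z ∈ upTo (length xs)
  y∷xs⊆upTo (here refl)  = ∈-upTo⁺ y<n
  y∷xs⊆upTo (there z∈xs) = ∈-upTo⁺ (All.lookup bounded z∈xs)

map-map-pred : ∀ {f : ℕ → ℕ} {xs} → All (λ x → f (pred x) ≡ x) xs → map f (map pred xs) ≡ xs
map-map-pred {xs = xs} inverse = trans (sym (map-∘ xs)) (map-id-local inverse)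

fold-shift : ∀ {A : Set} (f : A → A) x i → fold (f x) f i ≡ f (fold x f i)
fold-shift f x zero    = refl
fold-shift f x (suc i) = cong f (fold-shift f x i)

nth-iterate : ∀ f x {k i} → i < k → nth (iterate f x k) i ≡ fold x f i
nth-iterate f x {suc k} {zero}  _   = refl
nth-iterate f x {suc k} {suc i} i<k = trans (nth-iterate f (f x) (s<s⁻¹ i<k)) (fold-shift f x i)

iterate-∷ʳ : ∀ {A : Set} (f : A → A) x k → iterate f x (suc k) ≡ iterate f x k ++ [ fold x f k ]
iterate-∷ʳ f x zero    = refl
iterate-∷ʳ f x (suc k) = cong (x ∷_) (trans (iterate-∷ʳ f (f x) k) (cong (λ y → iterate f (f x) k ++ [ y ]) (fold-shift f x k)))

All-iterate : ∀ {A : Set} {P : A → Set} (f : A → A) → (∀ {y} → P y → P (f y)) → ∀ {x} k → P x → All P (iterate f x k)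
All-iterate f closed zero    _  = []
All-iterate f closed (suc k) px = px ∷ All-iterate f closed k (closed px)

-- Occurrences of the pattern 213

data Contains213 (xs : List ℕ) : Set where
  occurrence : ∀ {a b c} → a < b → b < c → b ∷ a ∷ c ∷ [] ⊆ xs → Contains213 xs

Contains213-⊆ : ∀ {xs ys} → xs ⊆ ys → Contains213 xs → Contains213 ys
Contains213-⊆ τ (occurrence a<b b<c σ) = occurrence a<b b<c (⊆-trans σ τ)

⊆-map⁻ : ∀ {A B : Set} (f : A → B) {ys} xs → ys ⊆ map f xs → ∃[ zs ] (zs ⊆ xs × ys ≡ map f zs)
⊆-map⁻ f []       []        = [] , [] , refl
⊆-map⁻ f (x ∷ xs) (_ ∷ʳ τ)  with zs , σ , refl ← ⊆-map⁻ f xs τ = zs , x ∷ʳ σ , refl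
⊆-map⁻ f (x ∷ xs) (refl ∷ τ) with zs , σ , refl ← ⊆-map⁻ f xs τ = x ∷ zs , refl ∷ σ , refl

module _ {f : ℕ → ℕ} (f-mono : ∀ {x y} → x < y → f x < f y) (f-reflects : ∀ {x y} → f x < f y → x < y) where

  Contains213-map⁺ : ∀ {xs} → Contains213 xs → Contains213 (map f xs)
  Contains213-map⁺ (occurrence a<b b<c τ) = occurrence (f-mono a<b) (f-mono b<c) (Sublist.map⁺ f τ)

  Contains213-map⁻ : ∀ xs → Contains213 (map f xs) → Contains213 xs
  Contains213-map⁻ xs (occurrence a<b b<c τ)
    with b ∷ a ∷ c ∷ [] , σ , refl ← ⊆-map⁻ f xs τ = occurrence (f-reflects a<b) (f-reflects b<c) σ

Contains213-∷-min : ∀ {x xs} → All (x ≤_) xs → Contains213 (x ∷ xs) → Contains213 xs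
Contains213-∷-min _   (occurrence a<b b<c (_ ∷ʳ τ))  = occurrence a<b b<c τ
Contains213-∷-min x≤ (occurrence a<b b<c (refl ∷ τ)) =
  contradiction (All.lookup x≤ (Sublist.Any-resp-⊆ τ (here refl))) (<⇒≱ a<b)

Contains213-∷-max : ∀ {x xs} → All (_≤ x) xs → Contains213 (x ∷ xs) → Contains213 xs
Contains213-∷-max _   (occurrence a<b b<c (_ ∷ʳ τ))  = occurrence a<b b<c τ
Contains213-∷-max ≤x (occurrence a<b b<c (refl ∷ τ)) =
  contradiction (All.lookup ≤x (Sublist.Any-resp-⊆ (Sublist.∷ˡ⁻ τ) (here refl))) (<⇒≱ b<c)

∷ʳ-⊈-[] : ∀ {A : Set} (zs : List A) {z} → ¬ (zs ++ [ z ] ⊆ [])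
∷ʳ-⊈-[] []      ()
∷ʳ-⊈-[] (_ ∷ _) ()

⊆-∷ʳ⁻ : ∀ {A : Set} {z y : A} zs xs → z ≢ y → zs ++ [ z ] ⊆ xs ++ [ y ] → zs ++ [ z ] ⊆ xs
⊆-∷ʳ⁻ []       []       z≢y (_ ∷ʳ τ)    = contradiction τ (∷ʳ-⊈-[] [])
⊆-∷ʳ⁻ []       []       z≢y (refl ∷ τ)  = contradiction refl z≢y
⊆-∷ʳ⁻ (_ ∷ zs) []       z≢y (_ ∷ʳ τ)    = contradiction τ (∷ʳ-⊈-[] (_ ∷ zs))
⊆-∷ʳ⁻ (_ ∷ zs) []       z≢y (refl ∷ τ)  = contradiction τ (∷ʳ-⊈-[] zs)
⊆-∷ʳ⁻ zs       (x ∷ xs) z≢y (_ ∷ʳ τ)    = x ∷ʳ ⊆-∷ʳ⁻ zs xs z≢y τ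
⊆-∷ʳ⁻ []       (x ∷ xs) z≢y (refl ∷ τ)  = refl ∷ minimum xs
⊆-∷ʳ⁻ (_ ∷ zs) (x ∷ xs) z≢y (refl ∷ τ)  = refl ∷ ⊆-∷ʳ⁻ zs xs z≢y τ

-- In an occurrence the last letter exceeds two others, so it is at least 2.
Contains213-∷ʳ-small : ∀ {y} xs → y ≤ 1 → Contains213 (xs ++ [ y ]) → Contains213 xs
Contains213-∷ʳ-small xs y≤1 (occurrence {a} a<b b<c τ) =
  occurrence a<b b<c (⊆-∷ʳ⁻ (_ ∷ a ∷ []) xs (λ { refl → <⇒≱ (≤-<-trans (≤-<-trans z≤n a<b) b<c) y≤1 }) τ)

⊆-nth₁ : ∀ xs {k} → k < length xs → [ nth xs k ] ⊆ xs
⊆-nth₁ (x ∷ xs) {zero}  _   = refl ∷ minimum xs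
⊆-nth₁ (x ∷ xs) {suc k} k<l = x ∷ʳ ⊆-nth₁ xs (s<s⁻¹ k<l)

⊆-nth₂ : ∀ xs {j k} → j < k → k < length xs → nth xs j ∷ nth xs k ∷ [] ⊆ xs
⊆-nth₂ (x ∷ xs) {zero}  {suc k} _   k<l = refl ∷ ⊆-nth₁ xs (s<s⁻¹ k<l)
⊆-nth₂ (x ∷ xs) {suc j} {suc k} j<k k<l = x ∷ʳ ⊆-nth₂ xs (s<s⁻¹ j<k) (s<s⁻¹ k<l)

⊆-nth₃ : ∀ xs {i j k} → i < j → j < k → k < length xs → nth xs i ∷ nth xs j ∷ nth xs k ∷ [] ⊆ xs
⊆-nth₃ (x ∷ xs) {zero}  {suc j} {suc k} _   j<k k<l = refl ∷ ⊆-nth₂ xs (s<s⁻¹ j<k) (s<s⁻¹ k<l)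
⊆-nth₃ (x ∷ xs) {suc i} {suc j} {suc k} i<j j<k k<l = x ∷ʳ ⊆-nth₃ xs (s<s⁻¹ i<j) (s<s⁻¹ j<k) (s<s⁻¹ k<l)

Contains213-nth : ∀ xs {i j k} → i < j → j < k → k < length xs →
                  nth xs j < nth xs i → nth xs i < nth xs k → Contains213 xs
Contains213-nth xs i<j j<k k<l a<b b<c = occurrence a<b b<c (⊆-nth₃ xs i<j j<k k<l)

∈-subseqs⁺ : ∀ {s xs : List ℕ} → s ⊆ xs → s ∈ subseqs (length s) xs
∈-subseqs⁺ {[]}    _           = here refl
∈-subseqs⁺ {_ ∷ _} (_ ∷ʳ τ)    = ∈-++⁺ʳ _ (∈-subseqs⁺ τ)
∈-subseqs⁺ {_ ∷ _} (refl ∷ τ)  = ∈-++⁺ˡ (∈-map⁺ (_ ∷_) (∈-subseqs⁺ τ))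

∈-subseqs⁻ : ∀ k xs {s} → s ∈ subseqs k xs → s ⊆ xs × length s ≡ k
∈-subseqs⁻ zero    xs       (here refl) = minimum xs , refl
∈-subseqs⁻ (suc k) (x ∷ xs) s∈ with ∈-++⁻ (map (x ∷_) (subseqs k xs)) s∈
... | inj₂ s∈′ = let τ , l = ∈-subseqs⁻ (suc k) xs s∈′ in x ∷ʳ τ , l
... | inj₁ s∈′ with s′ , s′∈ , refl ← ∈-map⁻ (x ∷_) s∈′ =
  let τ , l = ∈-subseqs⁻ k xs s′∈ in refl ∷ τ , cong suc l

<ᵇ-true : ∀ {m n} → m < n → (m <ᵇ n) ≡ true
<ᵇ-true m<n = Equivalence.to T-≡ (<⇒<ᵇ m<n)

<ᵇ-false : ∀ {m n} → ¬ m < n → (m <ᵇ n) ≡ false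
<ᵇ-false {m} {n} m≮n with m <ᵇ n in eq
... | true  = contradiction (<ᵇ⇒< m n (Equivalence.from T-≡ eq)) m≮n
... | false = refl

sameOrder-213⁺ : ∀ {a b c} → a < b → b < c → T (sameOrder (b ∷ a ∷ c ∷ []) p213)
sameOrder-213⁺ {a} {b} {c} a<b b<c
  rewrite <ᵇ-false (n≮n a) | <ᵇ-false (n≮n b) | <ᵇ-false (n≮n c)
        | <ᵇ-true a<b | <ᵇ-true b<c | <ᵇ-true (<-trans a<b b<c)
        | <ᵇ-false (<⇒≯ a<b) | <ᵇ-false (<⇒≯ b<c) | <ᵇ-false (<⇒≯ (<-trans a<b b<c)) = tt

-- These four comparisons head the conjunction computed by sameOrder, so fixing them makes it reduce.
sameOrder-213⁻ : ∀ b a c → T (sameOrder (b ∷ a ∷ c ∷ []) p213) → a < b × b < c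
sameOrder-213⁻ b a c holds with b <ᵇ b | b <ᵇ a | b <ᵇ c in b<c | a <ᵇ b in a<b
sameOrder-213⁻ b a c () | true  | _     | _     | _
sameOrder-213⁻ b a c () | false | true  | _     | _
sameOrder-213⁻ b a c () | false | false | false | _
sameOrder-213⁻ b a c () | false | false | true  | false
sameOrder-213⁻ b a c _  | false | false | true  | true  =
  <ᵇ⇒< a b (Equivalence.from T-≡ a<b) , <ᵇ⇒< b c (Equivalence.from T-≡ b<c)

Contains213⇒contains : ∀ {xs} → Contains213 xs → T (contains p213 xs)
Contains213⇒contains (occurrence a<b b<c τ) =
  Any.any⁺ (λ s → sameOrder s p213) (lose (∈-subseqs⁺ τ) (sameOrder-213⁺ a<b b<c))

contains⇒Contains213 : ∀ xs → T (contains p213 xs) → Contains213 xs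
contains⇒Contains213 xs holds with find (Any.any⁻ (λ s → sameOrder s p213) (subseqs 3 xs) holds)
... | s , s∈ , order with ∈-subseqs⁻ 3 xs s∈
...   | τ , length≡3 = occurrence′ s length≡3 τ order
  where
  occurrence′ : ∀ s → length s ≡ 3 → s ⊆ xs → T (sameOrder s p213) → Contains213 xs
  occurrence′ (b ∷ a ∷ c ∷ []) _ τ order = let a<b , b<c = sameOrder-213⁻ b a c order in occurrence a<b b<c τ

avoids213⇔ : ∀ xs → T (avoids p213 xs) ⇔ (¬ Contains213 xs)
avoids213⇔ xs with contains p213 xs in eq
... | true  = mk⇔ (λ ()) (λ ¬occ → ¬occ (contains⇒Contains213 xs (Equivalence.from T-≡ eq)))
... | false = mk⇔ (λ _ occ → subst T eq (Contains213⇒contains occ)) (λ _ → tt)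

T-not-==⇔≢ : ∀ m n → T (not (m == n)) ⇔ (m ≢ n)
T-not-==⇔≢ zero    zero    = mk⇔ (λ ()) (λ 0≢0 → 0≢0 refl)
T-not-==⇔≢ zero    (suc n) = mk⇔ (λ _ ()) (λ _ → tt)
T-not-==⇔≢ (suc m) zero    = mk⇔ (λ _ ()) (λ _ → tt)
T-not-==⇔≢ (suc m) (suc n) = mk⇔ (λ t → to t ∘ suc-injective) (λ m≢n → from (m≢n ∘ cong suc))
  where open Equivalence (T-not-==⇔≢ m n)

distinct⇔Unique : ∀ xs → T (distinct xs) ⇔ Unique xs
distinct⇔Unique []       = mk⇔ (λ _ → []) (λ _ → tt)
distinct⇔Unique (x ∷ xs) = mk⇔
  (λ t → let fresh , rest = Equivalence.to T-∧ t
         in All.map (Equivalence.to (T-not-==⇔≢ x _)) (All.all⁺ _ xs fresh) ∷ Equivalence.to (distinct⇔Unique xs) rest)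
  (λ { (fresh ∷ rest) → Equivalence.from T-∧
         (All.all⁻ _ (All.map (Equivalence.from (T-not-==⇔≢ x _)) fresh) , Equivalence.from (distinct⇔Unique xs) rest) })

-- Admissible permutations

cycleOf : List ℕ → List ℕ
cycleOf w = iterate (nth w) 0 (length w)

-- w is the one-line notation, on the labels 0, …, n-1, of a member of 𝒜_n(213;213).
record Admissible (n : ℕ) (w : List ℕ) : Set where
  field
    length≡         : length w ≡ n
    bounded         : All (_< n) w
    unique          : Unique w
    cycle-unique    : Unique (cycleOf w)
    avoids213       : ¬ Contains213 w
    cycle-avoids213 : ¬ Contains213 (cycleOf w)

module Orbit {n w} (adm : Admissible n w) where
  open Admissible adm

  π : ℕ → ℕ
  π = nth w

  -- c i is the entry c_{i+1} of the cycle notation (shifted down by one).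
  c : ℕ → ℕ
  c i = fold 0 π i

  <length : ∀ {i} → i < n → i < length w
  <length = subst (_ <_) (sym length≡)

  length-cycle : length (cycleOf w) ≡ n
  length-cycle = trans (length-iterate π 0 (length w)) length≡

  nth-cycle : ∀ {i} → i < n → nth (cycleOf w) i ≡ c i
  nth-cycle i<n = nth-iterate π 0 (<length i<n)

  π-< : ∀ {x} → x < n → π x < n
  π-< x<n = All-nth bounded (<length x<n)

  π-injective : ∀ {x y} → x < n → y < n → π x ≡ π y → x ≡ y
  π-injective x<n y<n = nth-injective unique (<length x<n) (<length y<n)

  π-surjective : ∀ {y} → y < n → ∃[ x ] (x < n × π x ≡ y)
  π-surjective y<n with x , x<l , eq ← ∈⇒nth (Unique-bounded⇒∈ unique bounded length≡ y<n) =
    x , subst (_ <_) length≡ x<l , eq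

  c-< : 0 < n → ∀ i → c i < n
  c-< 0<n zero    = 0<n
  c-< 0<n (suc i) = π-< (c-< 0<n i)

  c-injective : ∀ {i j} → i < n → j < n → c i ≡ c j → i ≡ j
  c-injective {i} {j} i<n j<n eq =
    nth-injective cycle-unique (<len i<n) (<len j<n) (trans (nth-cycle i<n) (trans eq (sym (nth-cycle j<n))))
    where
    <len : ∀ {k} → k < n → k < length (cycleOf w)
    <len = subst (_ <_) (sym length-cycle)

  π0≢0 : 1 < n → π 0 ≢ 0
  π0≢0 1<n eq = contradiction (c-injective 1<n (<-trans (s≤s z≤n) 1<n) eq) λ ()

  c-surjective : ∀ {y} → y < n → ∃[ i ] (i < n × c i ≡ y)
  c-surjective y<n
    with i , i<l , eq ← ∈⇒nth (Unique-bounded⇒∈ cycle-unique (All-iterate π π-< (length w) (≤-<-trans z≤n y<n))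
                                                 length-cycle y<n) =
    let i<n = subst (_ <_) length-cycle i<l in i , i<n , trans (sym (nth-cycle i<n)) eq

  c-closes : ∀ {m} → n ≡ suc m → π (c m) ≡ 0
  c-closes {m} refl with c-surjective (π-< (c-< (s≤s z≤n) m))
  ... | zero  , _ , eq = sym eq
  ... | suc j , j<n , eq = contradiction (subst (_< suc m) (cong suc j≡m) j<n) (n≮n (suc m))
    where
    j≡m : j ≡ m
    j≡m = c-injective (<-trans (n<1+n j) j<n) ≤-refl (π-injective (c-< (s≤s z≤n) j) (c-< (s≤s z≤n) m) eq)

  π-avoids : ∀ {i j k} → i < j → j < k → k < n → π j < π i → π i < π k → ⊥
  π-avoids i<j j<k k<n a<b b<c = avoids213 (Contains213-nth w i<j j<k (<length k<n) a<b b<c)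

  c-avoids : ∀ {i j k} → i < j → j < k → k < n → c j < c i → c i < c k → ⊥
  c-avoids {i} {j} {k} i<j j<k k<n a<b b<c = cycle-avoids213 (Contains213-nth (cycleOf w) i<j j<k
    (subst (_ <_) (sym length-cycle) k<n)
    (subst₂ _<_ (sym (nth-cycle j<n)) (sym (nth-cycle i<n)) a<b)
    (subst₂ _<_ (sym (nth-cycle i<n)) (sym (nth-cycle k<n)) b<c))
    where
    j<n : j < n
    j<n = <-trans j<k k<n
    i<n : i < n
    i<n = <-trans i<j j<n

data Shape (m : ℕ) (w : List ℕ) : Set where
  head-1            : nth w 0 ≡ 1 → nth w m ≡ 0 → Shape m w
  head-max∧last-1   : nth w 0 ≡ m → nth w m ≡ 1 → Shape m w
  head-max∧second-0 : nth w 0 ≡ m → nth w 1 ≡ 0 → nth w m ≢ 1 → Shape m w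

module Classification {m w} (adm : Admissible (suc m) w) (2≤m : 2 ≤ m) where
  open Orbit adm

  0<n : 0 < suc m
  0<n = s≤s z≤n
  1<n : 1 < suc m
  1<n = s≤s (≤-trans (s≤s z≤n) 2≤m)
  2<n : 2 < suc m
  2<n = s≤s 2≤m
  m<n : m < suc m
  m<n = ≤-refl

  2≤ : ∀ {x} → x ≢ 0 → x ≢ 1 → 2 ≤ x
  2≤ x≢0 x≢1 = ≤∧≢⇒< (n≢0⇒n>0 x≢0) (x≢1 ∘ sym)

  π0≡m⇒πm≢0 : π 0 ≡ m → π m ≢ 0
  π0≡m⇒πm≢0 π0≡m πm≡0 = contradiction (c-injective 2<n 0<n (trans (cong π π0≡m) πm≡0)) λ ()

  -- Otherwise 0 = π q with 0 < q < m, and π 0, π q, π m = 1, 0, π m is a 213.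
  π0≡1⇒πm≡0 : π 0 ≡ 1 → π m ≡ 0
  π0≡1⇒πm≡0 π0≡1 with q , q<n , πq≡0 ← π-surjective 0<n with m≤n⇒m<n∨m≡n (s≤s⁻¹ q<n)
  ... | inj₂ refl = πq≡0
  ... | inj₁ q<m  = ⊥-elim $ π-avoids 0<q q<m m<n (subst₂ _<_ (sym πq≡0) (sym π0≡1) (s≤s z≤n))
                                                    (subst (_< π m) (sym π0≡1) 1<πm)
    where
    0<q : 0 < q
    0<q = n≢0⇒n>0 λ { refl → π0≢0 1<n πq≡0 }
    1<πm : 1 < π m
    1<πm = 2≤ (λ πm≡0 → <⇒≢ q<m (π-injective q<n m<n (trans πq≡0 (sym πm≡0))))
              (λ πm≡1 → contradiction (π-injective m<n 0<n (trans πm≡1 (sym π0≡1)))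
                                      (<⇒≢ (<-≤-trans (s≤s z≤n) 2≤m) ∘ sym))

  -- Otherwise, if π 1 < π m then π 1, 0, π m is a 213 in π; if π m < π 1 then
  -- π m, 1, π 1 is a 213 in the cycle, at positions 2, s, s+1 where c s = 1.
  π0≡m⇒π1≡0 : π 0 ≡ m → π m ≢ 1 → π 1 ≡ 0
  π0≡m⇒π1≡0 π0≡m πm≢1 with π 1 ≟ 0
  ... | yes π1≡0 = π1≡0
  ... | no  π1≢0 with <-cmp (π 1) (π m)
  ...   | tri≈ _ π1≡πm _ = contradiction (π-injective 1<n m<n π1≡πm) (<⇒≢ (≤-trans (s≤s (s≤s z≤n)) 2≤m))
  ...   | tri< π1<πm _ _ with q , q<n , πq≡0 ← π-surjective 0<n =
    ⊥-elim $ π-avoids 1<q q<m m<n (subst (_< π 1) (sym πq≡0) (n≢0⇒n>0 π1≢0)) π1<πm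
    where
    1<q : 1 < q
    1<q = 2≤ (λ { refl → π0≢0 1<n πq≡0 }) (λ { refl → π1≢0 πq≡0 })
    q<m : q < m
    q<m = ≤∧≢⇒< (s≤s⁻¹ q<n) (λ { refl → π0≡m⇒πm≢0 π0≡m πq≡0 })
  ...   | tri> _ _ πm<π1 with s , s<n , cs≡1 ← c-surjective 1<n =
    ⊥-elim $ c-avoids 2<s (n<1+n s) (s≤s s<m) (subst₂ _<_ (sym cs≡1) (sym c2≡πm) (2≤ (π0≡m⇒πm≢0 π0≡m) πm≢1))
                                     (subst₂ _<_ (sym c2≡πm) (cong π (sym cs≡1)) πm<π1)
    where
    c2≡πm : c 2 ≡ π m
    c2≡πm = cong π π0≡m
    2<s : 2 < s
    2<s = ≤∧≢⇒< (2≤ (λ { refl → contradiction cs≡1 λ () })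
                    (λ { refl → <⇒≢ (≤-trans (s≤s (s≤s z≤n)) 2≤m) (sym (trans (sym π0≡m) cs≡1)) }))
                (λ { refl → πm≢1 (trans (sym c2≡πm) cs≡1) })
    s<m : s < m
    s<m = ≤∧≢⇒< (s≤s⁻¹ s<n) (λ { refl → π1≢0 (trans (cong π (sym cs≡1)) (c-closes refl)) })

  module _ (2≤π0 : 2 ≤ π 0) (π0<m : π 0 < m) where

    -- Both π (m-1) and π m fall below π 0: otherwise 0 and 1 would both have preimage m.
    below-head : ∀ {p} → p < suc m → m ≤ suc p → π p < π 0
    below-head {p} p<n m≤1+p with <-cmp (π p) (π 0)
    ... | tri< πp<π0 _ _ = πp<π0
    ... | tri≈ _ πp≡π0 _ = contradiction (π-injective p<n 0<n πp≡π0) (<⇒≢ 0<p ∘ sym)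
      where
      0<p : 0 < p
      0<p = <-≤-trans (s≤s z≤n) (≤-trans 2≤π0 (s≤s⁻¹ (≤-trans π0<m m≤1+p)))
    ... | tri> _ _ π0<πp
      with q₀ , q₀<n , πq₀≡0 ← π-surjective 0<n | q₁ , q₁<n , πq₁≡1 ← π-surjective 1<n =
      contradiction (trans (sym πq₀≡0) (trans (cong π q₀≡q₁) πq₁≡1)) λ ()
      where
      only-last : ∀ {q} → q < suc m → q ≢ 0 → π q < π 0 → q ≡ m
      only-last {q} q<n q≢0 πq<π0 with <-cmp q p
      ... | tri< q<p _ _  = ⊥-elim (π-avoids (n≢0⇒n>0 q≢0) q<p p<n πq<π0 π0<πp)
      ... | tri≈ _ refl _ = contradiction π0<πp (<⇒≯ πq<π0)
      ... | tri> _ _ p<q  = ≤-antisym (s≤s⁻¹ q<n) (≤-trans m≤1+p p<q)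
      below : ∀ {q x} → π q ≡ x → x < 2 → π q < π 0
      below πq≡x x<2 = subst (_< π 0) (sym πq≡x) (<-≤-trans x<2 2≤π0)
      nonzero : ∀ {q x} → π q ≡ x → x < 2 → q ≢ 0
      nonzero πq≡x x<2 refl = <⇒≱ (below πq≡x x<2) ≤-refl
      q₀≡q₁ : q₀ ≡ q₁
      q₀≡q₁ = trans (only-last q₀<n (nonzero πq₀≡0 (s≤s z≤n)) (below πq₀≡0 (s≤s z≤n)))
                (sym (only-last q₁<n (nonzero πq₁≡1 ≤-refl) (below πq₁≡1 ≤-refl)))

    -- Of m-1 and m, the one met first in the cycle is followed by a value below c 1 = π 0, the other exceeds it.
    cycle-dip : ∀ {u v} → 0 < u → u < v → v < suc m → π (c u) < c 1 → c 1 < c v → ⊥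
    cycle-dip 0<u u<v v<n πcu<c1 c1<cv =
      c-avoids (s≤s 0<u) (≤∧≢⇒< u<v λ { refl → <-asym πcu<c1 c1<cv }) v<n πcu<c1 c1<cv

    m′ : ℕ
    m′ = pred m

    1+m′≡m : suc m′ ≡ m
    1+m′≡m = suc-pred m {{>-nonZero (<-≤-trans (s≤s z≤n) 2≤m)}}

    m′<m : m′ < m
    m′<m = subst (m′ <_) 1+m′≡m ≤-refl

    m′<n : m′ < suc m
    m′<n = <-trans m′<m m<n

    0<m′ : 0 < m′
    0<m′ = s≤s⁻¹ (subst (2 ≤_) (sym 1+m′≡m) 2≤m)

    head-not-middle : ⊥
    head-not-middle with s , s<n , cs≡m′ ← c-surjective m′<n | t , t<n , ct≡m ← c-surjective m<n
      with <-cmp s t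
    ... | tri< s<t _ _  = cycle-dip 0<s s<t t<n
                            (subst (λ x → π x < π 0) (sym cs≡m′) (below-head m′<n (≤-reflexive (sym 1+m′≡m))))
                            (subst (π 0 <_) (sym ct≡m) π0<m)
      where
      0<s : 0 < s
      0<s = n≢0⇒n>0 λ { refl → <⇒≢ 0<m′ cs≡m′ }
    ... | tri≈ _ refl _ = <-irrefl (trans (sym cs≡m′) ct≡m) m′<m
    ... | tri> _ _ t<s  = cycle-dip 0<t t<s s<n
                            (subst (λ x → π x < π 0) (sym ct≡m) (below-head m<n (n≤1+n m)))
                            (subst (π 0 <_) (sym cs≡m′) π0<m′)
      where
      0<t : 0 < t
      0<t = n≢0⇒n>0 λ { refl → <⇒≢ (<-≤-trans (s≤s z≤n) 2≤m) ct≡m }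
      π0<m′ : π 0 < m′
      π0<m′ = ≤∧≢⇒< (s≤s⁻¹ (subst (suc (π 0) ≤_) (sym 1+m′≡m) π0<m)) λ π0≡m′ →
        <⇒≱ (subst (t <_) (c-injective s<n 1<n (trans cs≡m′ (sym π0≡m′))) t<s) 0<t

  classify : Shape m w
  classify with π 0 ≟ 1
  ... | yes π0≡1 = head-1 π0≡1 (π0≡1⇒πm≡0 π0≡1)
  ... | no  π0≢1 with π 0 ≟ m
  ...   | no  π0≢m = ⊥-elim (head-not-middle (2≤ (π0≢0 1<n) π0≢1) (≤∧≢⇒< (s≤s⁻¹ (π-< 0<n)) π0≢m))
  ...   | yes π0≡m with π m ≟ 1
  ...     | yes πm≡1 = head-max∧last-1 π0≡m πm≡1
  ...     | no  πm≢1 = head-max∧second-0 π0≡m (π0≡m⇒π1≡0 π0≡m πm≢1) πm≢1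

-- Growing admissible permutations

punchIn₁ : ℕ → ℕ
punchIn₁ zero    = zero
punchIn₁ (suc x) = suc (suc x)

punchIn₁-mono : ∀ {x y} → x < y → punchIn₁ x < punchIn₁ y
punchIn₁-mono {zero}  {suc y} _   = s≤s z≤n
punchIn₁-mono {suc x} {suc y} x<y = s≤s x<y

punchIn₁-reflects : ∀ {x y} → punchIn₁ x < punchIn₁ y → x < y
punchIn₁-reflects {zero}  {suc y} _ = s≤s z≤n
punchIn₁-reflects {suc x} {suc y} p = s≤s⁻¹ p

punchIn₁-injective : ∀ {x y} → punchIn₁ x ≡ punchIn₁ y → x ≡ y
punchIn₁-injective {zero}  {zero}  _  = refl
punchIn₁-injective {suc x} {suc y} eq = suc-injective eq

punchIn₁≢1 : ∀ x → punchIn₁ x ≢ 1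
punchIn₁≢1 zero    ()
punchIn₁≢1 (suc x) ()

punchIn₁-pred : ∀ {x} → x ≢ 1 → punchIn₁ (pred x) ≡ x
punchIn₁-pred {zero}          _   = refl
punchIn₁-pred {suc zero}      x≢1 = contradiction refl x≢1
punchIn₁-pred {suc (suc x)}   _   = refl

punchIn₁-≢0 : ∀ {x} → x ≢ 0 → punchIn₁ x ≡ suc x
punchIn₁-≢0 {zero}  x≢0 = contradiction refl x≢0
punchIn₁-≢0 {suc x} _   = refl

punchIn₁-≤ : ∀ {x n} → x < n → punchIn₁ x ≤ n
punchIn₁-≤ {zero}  _   = z≤n
punchIn₁-≤ {suc x} x<n = x<n

punchIn₁-<⁻ : ∀ {x n} → 0 < n → punchIn₁ x < suc n → x < n
punchIn₁-<⁻ {zero}  0<n _ = 0<n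
punchIn₁-<⁻ {suc x} _   p = s≤s⁻¹ p

nth-map-punchIn₁ : ∀ xs i → nth (map punchIn₁ xs) i ≡ punchIn₁ (nth xs i)
nth-map-punchIn₁ []       i       = refl
nth-map-punchIn₁ (x ∷ xs) zero    = refl
nth-map-punchIn₁ (x ∷ xs) (suc i) = nth-map-punchIn₁ xs i

module _ {hw hd : ℕ → ℕ} {P : ℕ → Set} {z : ℕ}
         (closed : ∀ {y} → P y → hd y ≢ 0 → P (hd y))
         (lift   : ∀ {y} → P y → hd y ≢ 0 → hw (suc y) ≡ suc (hd y))
         (hit    : ∀ {y} → P y → hd y ≡ 0 → hw (suc y) ≡ z) where

  -- Up to the shift by one, the orbits of hw and hd agree until that of hd returns to 0.
  private
    fresh⇒hd≢0 : ∀ {x k} → P x → 0 ∉ iterate hd (hd x) (suc k) ⊎ z ∉ iterate hw (hw (suc x)) (suc k) → hd x ≢ 0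
    fresh⇒hd≢0 _  (inj₁ 0∉) hdx≡0 = 0∉ (here (sym hdx≡0))
    fresh⇒hd≢0 px (inj₂ z∉) hdx≡0 = z∉ (here (sym (hit px hdx≡0)))

  iterate-lift : ∀ {x} k → P x → 0 ∉ iterate hd (hd x) k ⊎ z ∉ iterate hw (hw (suc x)) k →
                 iterate hw (suc x) (suc k) ≡ map suc (iterate hd x (suc k))
  iterate-lift     zero    _  _     = refl
  iterate-lift {x} (suc k) px fresh =
    cong (suc x ∷_) (trans (cong (λ y → iterate hw y (suc k)) hwx≡)
      (iterate-lift k (closed px hdx≢0)
        (Data.Sum.map (_∘ there) (λ z∉ → z∉ ∘ there ∘ subst (λ y → z ∈ iterate hw (hw y) k) (sym hwx≡)) fresh)))
    where
    hdx≢0 : hd x ≢ 0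
    hdx≢0 = fresh⇒hd≢0 px fresh
    hwx≡ : hw (suc x) ≡ suc (hd x)
    hwx≡ = lift px hdx≢0

  iterate-lift-hit : ∀ {x} k → P x →
                     0 ∉ iterate hd (hd x) k × fold x hd (suc k) ≡ 0 ⊎
                     z ∉ iterate hw (hw (suc x)) k × fold (suc x) hw (suc k) ≡ z →
                     iterate hw (suc x) (suc (suc k)) ≡ map suc (iterate hd x (suc k)) ++ [ z ]
  iterate-lift-hit     zero    px (inj₁ (_ , hdx≡0)) = cong (λ y → suc _ ∷ [ y ]) (hit px hdx≡0)
  iterate-lift-hit     zero    px (inj₂ (_ , hwx≡z)) = cong (λ y → suc _ ∷ [ y ]) hwx≡z
  iterate-lift-hit {x} (suc k) px fresh =
    cong (suc x ∷_) (trans (cong (λ y → iterate hw y (suc (suc k))) hwx≡)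
      (iterate-lift-hit k (closed px hdx≢0)
        (Data.Sum.map (λ (0∉ , last) → 0∉ ∘ there , trans (fold-shift hd x (suc k)) last)
                      (λ (z∉ , last) → z∉ ∘ there ∘ subst (λ y → z ∈ iterate hw (hw y) k) (sym hwx≡)
                                     , trans (cong (λ y → fold y hw (suc k)) (sym hwx≡)) (trans (fold-shift hw (suc x) (suc k)) last))
                      fresh)))
    where
    hdx≢0 : hd x ≢ 0
    hdx≢0 = fresh⇒hd≢0 px (Data.Sum.map proj₁ proj₁ fresh)
    hwx≡ : hw (suc x) ≡ suc (hd x)
    hwx≡ = lift px hdx≢0

withHead1 : List ℕ → List ℕ
withHead1 ρ = 1 ∷ map punchIn₁ ρ

cycle-withHead1 : ∀ {k} ρ → length ρ ≡ suc k →
                  0 ∉ iterate (nth ρ) (nth ρ 0) k ⊎ 0 ∉ iterate (nth (withHead1 ρ)) (nth (withHead1 ρ) 1) k →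
                  cycleOf (withHead1 ρ) ≡ 0 ∷ map suc (cycleOf ρ)
cycle-withHead1 {k} ρ length≡ fresh rewrite length-map punchIn₁ ρ | length≡ =
  cong (0 ∷_) (iterate-lift {P = λ _ → ⊤} (λ _ _ → tt) lift hit k tt fresh)
  where
  lift : ∀ {y} → ⊤ → nth ρ y ≢ 0 → nth (map punchIn₁ ρ) y ≡ suc (nth ρ y)
  lift {y} _ ρy≢0 = trans (nth-map-punchIn₁ ρ y) (punchIn₁-≢0 ρy≢0)
  hit : ∀ {y} → ⊤ → nth ρ y ≡ 0 → nth (map punchIn₁ ρ) y ≡ 0
  hit {y} _ ρy≡0 = trans (nth-map-punchIn₁ ρ y) (cong punchIn₁ ρy≡0)

withHead1-admissible : ∀ {k} σ → Admissible (suc k) (σ ++ [ 0 ]) → Admissible (suc (suc k)) (withHead1 (σ ++ [ 0 ]))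
withHead1-admissible {k} σ adm = record
  { length≡         = cong suc (trans (length-map punchIn₁ ρ) length≡)
  ; bounded         = s≤s (s≤s z≤n) ∷ All.map⁺ (All.map (s≤s ∘ punchIn₁-≤) bounded)
  ; unique          = All.map⁺ (All.tabulate (λ {x} _ → punchIn₁≢1 x ∘ sym)) ∷ Unique.map⁺ punchIn₁-injective unique
  ; cycle-unique    = subst Unique (sym cycle≡) (All.map⁺ (All.tabulate λ _ ()) ∷ Unique.map⁺ suc-injective cycle-unique)
  ; avoids213       = avoids213 ∘ Contains213-⊆ (Sublist.++⁺ʳ [ 0 ] ⊆-refl)
                    ∘ Contains213-map⁻ punchIn₁-mono punchIn₁-reflects σ ∘ Contains213-∷-min 1≤σ
                    ∘ Contains213-∷ʳ-small (1 ∷ map punchIn₁ σ) z≤n ∘ subst (Contains213 ∘ (1 ∷_)) (map-++ punchIn₁ σ [ 0 ])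
  ; cycle-avoids213 = cycle-avoids213 ∘ Contains213-map⁻ s≤s s≤s⁻¹ (cycleOf ρ)
                    ∘ Contains213-∷-min (All.tabulate λ _ → z≤n) ∘ subst Contains213 cycle≡
  }
  where
  ρ : List ℕ
  ρ = σ ++ [ 0 ]
  open Admissible adm
  cycle≡ : cycleOf (withHead1 ρ) ≡ 0 ∷ map suc (cycleOf ρ)
  cycle≡ = cycle-withHead1 ρ length≡ (inj₁ (Unique-head (subst (Unique ∘ iterate (nth ρ) 0) length≡ cycle-unique)))
  1≤σ : All (1 ≤_) (map punchIn₁ σ)
  1≤σ = All.map⁺ (All.tabulate λ x∈σ →
          subst (1 ≤_) (sym (punchIn₁-≢0 λ { refl → proj₂ (Unique-∷ʳ⁻ σ unique) x∈σ })) (s≤s z≤n))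

withHead1-admissible⁻ : ∀ {k} ρ → length ρ ≡ suc k → Admissible (suc (suc k)) (withHead1 ρ) → Admissible (suc k) ρ
withHead1-admissible⁻ {k} ρ length≡ρ adm = record
  { length≡         = length≡ρ
  ; bounded         = All.map (punchIn₁-<⁻ (s≤s z≤n)) (All.map⁻ (All.tail bounded))
  ; unique          = Unique.map⁻ (AllPairs.tail unique)
  ; cycle-unique    = Unique.map⁻ (AllPairs.tail (subst Unique cycle≡ cycle-unique))
  ; avoids213       = avoids213 ∘ Contains213-⊆ (1 ∷ʳ ⊆-refl) ∘ Contains213-map⁺ punchIn₁-mono punchIn₁-reflects
  ; cycle-avoids213 = cycle-avoids213 ∘ subst Contains213 (sym cycle≡) ∘ Contains213-⊆ (0 ∷ʳ ⊆-refl)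
                    ∘ Contains213-map⁺ s≤s s≤s⁻¹
  }
  where
  open Admissible adm
  cycle≡ : cycleOf (withHead1 ρ) ≡ 0 ∷ map suc (cycleOf ρ)
  cycle≡ = cycle-withHead1 ρ length≡ρ (inj₂ (Unique-head
    (subst (Unique ∘ iterate (nth (withHead1 ρ)) 0 ∘ suc) (trans (length-map punchIn₁ ρ) length≡ρ) cycle-unique) ∘ there))

withLast1 : List ℕ → List ℕ
withLast1 d = suc (length d) ∷ map punchIn₁ d ++ [ 1 ]

length-withLast1 : ∀ {k} d → length d ≡ suc k → length (withLast1 d) ≡ suc (suc (suc k))
length-withLast1 d length≡ = cong suc (trans (length-∷ʳ (map punchIn₁ d)) (cong suc (trans (length-map punchIn₁ d) length≡)))

cycle-withLast1-prefix : ∀ {k} d → length d ≡ suc k →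
                         cycleOf (withLast1 d) ≡ 0 ∷ suc (length d) ∷ iterate (nth (withLast1 d)) 1 (suc k)
cycle-withLast1-prefix d length≡ =
  trans (cong (iterate (nth (withLast1 d)) 0) (length-withLast1 d length≡))
        (cong (λ x → 0 ∷ suc (length d) ∷ iterate (nth (withLast1 d)) x (suc _))
              (subst (λ l → nth (map punchIn₁ d ++ [ 1 ]) l ≡ 1) (length-map punchIn₁ d) (nth-++-length (map punchIn₁ d))))

cycle-withLast1 : ∀ {k} d → length d ≡ suc k → All (_< suc k) d →
                  0 ∉ iterate (nth d) (nth d 0) k ⊎ 0 ∉ iterate (nth (withLast1 d)) (nth (withLast1 d) 1) k →
                  cycleOf (withLast1 d) ≡ 0 ∷ suc (length d) ∷ map suc (cycleOf d)
cycle-withLast1 {k} d length≡ bounded fresh = begin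
  cycleOf (withLast1 d)
    ≡⟨ cycle-withLast1-prefix d length≡ ⟩
  0 ∷ suc (length d) ∷ iterate hw 1 (suc k)
    ≡⟨ cong ((0 ∷_) ∘ (suc (length d) ∷_)) (iterate-lift closed lift hit k (s≤s z≤n) fresh) ⟩
  0 ∷ suc (length d) ∷ map suc (iterate (nth d) 0 (suc k))
    ≡⟨ cong (λ l → 0 ∷ suc (length d) ∷ map suc (iterate (nth d) 0 l)) (sym length≡) ⟩
  0 ∷ suc (length d) ∷ map suc (cycleOf d) ∎
  where
  open ≡-Reasoning
  hw : ℕ → ℕ
  hw = nth (withLast1 d)
  <length : ∀ {y} → y < suc k → y < length (map punchIn₁ d)
  <length = subst (_ <_) (sym (trans (length-map punchIn₁ d) length≡))
  closed : ∀ {y} → y < suc k → nth d y ≢ 0 → nth d y < suc k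
  closed y<k _ = All-nth bounded (subst (_ <_) (sym length≡) y<k)
  hw-suc : ∀ {y} → y < suc k → hw (suc y) ≡ punchIn₁ (nth d y)
  hw-suc {y} y<k = trans (nth-++ˡ (map punchIn₁ d) [ 1 ] (<length y<k)) (nth-map-punchIn₁ d y)
  lift : ∀ {y} → y < suc k → nth d y ≢ 0 → hw (suc y) ≡ suc (nth d y)
  lift y<k dy≢0 = trans (hw-suc y<k) (punchIn₁-≢0 dy≢0)
  hit : ∀ {y} → y < suc k → nth d y ≡ 0 → hw (suc y) ≡ 0
  hit y<k dy≡0 = trans (hw-suc y<k) (cong punchIn₁ dy≡0)

withLast1-admissible : ∀ {k d} → Admissible (suc k) d → Admissible (suc (suc (suc k))) (withLast1 d)
withLast1-admissible {k} {d} adm = record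
  { length≡         = length-withLast1 d length≡
  ; bounded         = s≤s (s≤s (≤-reflexive length≡)) ∷ All.map (s≤s ∘ m≤n⇒m≤1+n) body≤
  ; unique          = All.map (λ x≤ 1+L≡x → <⇒≱ 1+k<1+L (subst (_≤ suc k) (sym 1+L≡x) x≤)) body≤
                    ∷ Unique-∷ʳ⁺ (Unique.map⁺ punchIn₁-injective unique)
                                 (punchIn₁≢1 _ ∘ sym ∘ proj₂ ∘ proj₂ ∘ ∈-map⁻ punchIn₁)
  ; cycle-unique    = subst Unique (sym cycle≡)
                      ( ((λ ()) ∷ All.map⁺ (All.tabulate λ _ ()))
                      ∷ All.map⁺ (All.map (λ x<k 1+L≡1+x → <-irrefl (sym (trans (sym length≡) (suc-injective 1+L≡1+x))) x<k) cycle<)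
                      ∷ Unique.map⁺ suc-injective cycle-unique)
  ; avoids213       = avoids213 ∘ Contains213-map⁻ punchIn₁-mono punchIn₁-reflects d
                    ∘ Contains213-∷ʳ-small (map punchIn₁ d) ≤-refl
                    ∘ Contains213-∷-max (All.map (λ x≤ → ≤-trans x≤ k≤1+L) body≤)
  ; cycle-avoids213 = cycle-avoids213 ∘ Contains213-map⁻ s≤s s≤s⁻¹ (cycleOf d)
                    ∘ Contains213-∷-max (All.map⁺ (All.map (λ x<k → ≤-trans x<k k≤1+L) cycle<))
                    ∘ Contains213-∷-min (All.tabulate λ _ → z≤n) ∘ subst Contains213 cycle≡
  }
  where
  open Admissible adm
  1+k<1+L : suc k < suc (length d)
  1+k<1+L = s≤s (≤-reflexive (sym length≡))
  k≤1+L : suc k ≤ suc (length d)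
  k≤1+L = <⇒≤ 1+k<1+L
  body≤ : All (_≤ suc k) (map punchIn₁ d ++ [ 1 ])
  body≤ = All.++⁺ (All.map⁺ (All.map punchIn₁-≤ bounded)) (s≤s z≤n ∷ [])
  cycle< : All (_< suc k) (cycleOf d)
  cycle< = All-iterate (nth d) (λ {y} y<k → All-nth bounded (subst (y <_) (sym length≡) y<k)) (length d) (s≤s z≤n)
  cycle≡ : cycleOf (withLast1 d) ≡ 0 ∷ suc (length d) ∷ map suc (cycleOf d)
  cycle≡ = cycle-withLast1 d length≡ bounded (inj₁ (Unique-head (subst (Unique ∘ iterate (nth d) 0) length≡ cycle-unique)))

withLast1-admissible⁻ : ∀ {k} d → length d ≡ suc k → Admissible (suc (suc (suc k))) (withLast1 d) → Admissible (suc k) d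
withLast1-admissible⁻ {k} d length≡d adm = record
  { length≡         = length≡d
  ; bounded         = bounded-d
  ; unique          = Unique.map⁻ (proj₁ (Unique-∷ʳ⁻ (map punchIn₁ d) (AllPairs.tail unique)))
  ; cycle-unique    = Unique.map⁻ (AllPairs.tail (AllPairs.tail (subst Unique cycle≡ cycle-unique)))
  ; avoids213       = avoids213 ∘ Contains213-⊆ (_ ∷ʳ Sublist.++⁺ʳ [ 1 ] ⊆-refl)
                    ∘ Contains213-map⁺ punchIn₁-mono punchIn₁-reflects
  ; cycle-avoids213 = cycle-avoids213 ∘ subst Contains213 (sym cycle≡) ∘ Contains213-⊆ (0 ∷ʳ _ ∷ʳ ⊆-refl)
                    ∘ Contains213-map⁺ s≤s s≤s⁻¹
  }
  where
  open Admissible adm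
  bounded-d : All (_< suc k) d
  bounded-d = All.zipWith entry< (All.map⁻ (All.++⁻ˡ (map punchIn₁ d) (All.tail bounded)) ,
                                  All.map⁻ (All.++⁻ˡ (map punchIn₁ d) (AllPairs.head unique)))
    where
    entry< : ∀ {x} → punchIn₁ x < suc (suc (suc k)) × suc (length d) ≢ punchIn₁ x → x < suc k
    entry< (x< , x≢) = punchIn₁-<⁻ (s≤s z≤n) (≤∧≢⇒< (s≤s⁻¹ x<) (x≢ ∘ trans (cong suc length≡d) ∘ sym))
  cycle≡ : cycleOf (withLast1 d) ≡ 0 ∷ suc (length d) ∷ map suc (cycleOf d)
  cycle≡ = cycle-withLast1 d length≡d bounded-d (inj₂ (Unique-head
    (subst Unique (cycle-withLast1-prefix d length≡d) cycle-unique) ∘ there ∘ there))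

withSecond0 : List ℕ → List ℕ
withSecond0 []       = []
withSecond0 (x ∷ xs) = suc x ∷ 0 ∷ map suc xs

cycle-withSecond0-prefix : ∀ {k} x xs → length xs ≡ suc k →
                           cycleOf (withSecond0 (x ∷ xs)) ≡ 0 ∷ iterate (nth (withSecond0 (x ∷ xs))) (suc x) (suc (suc k))
cycle-withSecond0-prefix x xs length≡ =
  cong (iterate (nth (withSecond0 (x ∷ xs))) 0 ∘ suc ∘ suc) (trans (length-map suc xs) length≡)

cycle-withSecond0 : ∀ {k} x xs → length xs ≡ suc k → All (_< suc (suc k)) (x ∷ xs) → 0 < x →
                    let hw = nth (withSecond0 (x ∷ xs)); he = nth (x ∷ xs) in
                    0 ∉ iterate he (he x) k × fold x he (suc k) ≡ 0 ⊎
                    1 ∉ iterate hw (hw (suc x)) k × fold (suc x) hw (suc k) ≡ 1 →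
                    cycleOf (withSecond0 (x ∷ xs)) ≡ 0 ∷ map suc (iterate he x (suc k)) ++ [ 1 ]
cycle-withSecond0 {k} x xs length≡ bounded 0<x fresh =
  trans (cycle-withSecond0-prefix x xs length≡)
        (cong (0 ∷_) (iterate-lift-hit {hw = hw} {he} {P} closed lift hit k (0<x , All.head bounded) fresh))
  where
  hw he : ℕ → ℕ
  hw = nth (withSecond0 (x ∷ xs))
  he = nth (x ∷ xs)
  P : ℕ → Set
  P y = 0 < y × y < suc (suc k)
  closed : ∀ {y} → P y → he y ≢ 0 → P (he y)
  closed {y} (_ , y<) hey≢0 = n≢0⇒n>0 hey≢0 , All-nth bounded (subst (y <_) (cong suc (sym length≡)) y<)
  hw-suc : ∀ {y} → P y → hw (suc y) ≡ suc (he y)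
  hw-suc {suc y} (_ , y<) = nth-map suc xs (subst (y <_) (sym length≡) (s≤s⁻¹ y<))
  lift : ∀ {y} → P y → he y ≢ 0 → hw (suc y) ≡ suc (he y)
  lift py _ = hw-suc py
  hit : ∀ {y} → P y → he y ≡ 0 → hw (suc y) ≡ 1
  hit py hey≡0 = trans (hw-suc py) (cong suc hey≡0)

withSecond0-admissible : ∀ {k x xs} → Admissible (suc (suc k)) (x ∷ xs) → x ≡ suc k →
                         Admissible (suc (suc (suc k))) (withSecond0 (x ∷ xs))
withSecond0-admissible {k} {x} {xs} adm refl = record
  { length≡         = cong (suc ∘ suc) (trans (length-map suc xs) length≡xs)
  ; bounded         = s≤s (All.head bounded) ∷ s≤s z≤n ∷ All.map⁺ (All.map s≤s (All.tail bounded))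
  ; unique          = ((λ ()) ∷ All.map⁺ (All.map (_∘ suc-injective) (AllPairs.head unique)))
                    ∷ All.map⁺ (All.tabulate λ _ ()) ∷ Unique.map⁺ suc-injective (AllPairs.tail unique)
  ; cycle-unique    = subst Unique (sym cycle≡)
                      (All.++⁺ (All.map⁺ {xs = tailCycle} (All.tabulate λ _ ())) ((λ ()) ∷ [])
                       ∷ Unique-∷ʳ⁺ (Unique.map⁺ suc-injective (AllPairs.tail cycle-unique′))
                                    (λ 1∈ → let y , y∈ , 1≡1+y = ∈-map⁻ suc 1∈
                                            in Unique-head cycle-unique′ (subst (_∈ _) (sym (suc-injective 1≡1+y)) y∈)))
  ; avoids213       = avoids213 ∘ Contains213-⊆ (x ∷ʳ ⊆-refl) ∘ Contains213-map⁻ s≤s s≤s⁻¹ xs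
                    ∘ Contains213-∷-min (All.tabulate λ _ → z≤n) ∘ Contains213-∷-max (z≤n ∷ All.map⁺ (All.tail bounded))
  ; cycle-avoids213 = cycle-avoids213 ∘ subst Contains213 (sym cycle-e) ∘ Contains213-⊆ (0 ∷ʳ ⊆-refl)
                    ∘ Contains213-map⁻ s≤s s≤s⁻¹ tailCycle ∘ Contains213-∷ʳ-small (map suc tailCycle) ≤-refl
                    ∘ Contains213-∷-min (All.tabulate λ _ → z≤n) ∘ subst Contains213 cycle≡
  }
  where
  open Admissible adm
  he : ℕ → ℕ
  he = nth (x ∷ xs)
  length≡xs : length xs ≡ suc k
  length≡xs = suc-injective length≡
  tailCycle : List ℕ
  tailCycle = iterate he x (suc k)
  cycle-e : cycleOf (x ∷ xs) ≡ 0 ∷ tailCycle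
  cycle-e = cong (iterate he 0) length≡
  cycle-unique′ : Unique (0 ∷ tailCycle)
  cycle-unique′ = subst Unique cycle-e cycle-unique
  cycle≡ : cycleOf (withSecond0 (x ∷ xs)) ≡ 0 ∷ map suc tailCycle ++ [ 1 ]
  cycle≡ = cycle-withSecond0 x xs length≡xs bounded (s≤s z≤n)
    (inj₁ (Unique-head cycle-unique′ ∘ there , trans (fold-shift he 0 (suc k)) (Orbit.c-closes adm refl)))

withSecond0-admissible⁻ : ∀ {k} x xs → length xs ≡ suc k → x ≡ suc k →
                          Admissible (suc (suc (suc k))) (withSecond0 (x ∷ xs)) → Admissible (suc (suc k)) (x ∷ xs)
withSecond0-admissible⁻ {k} x xs length≡xs refl adm = record
  { length≡         = cong suc length≡xs
  ; bounded         = bounded-e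
  ; unique          = All.map (_∘ cong suc) (All.map⁻ (All.tail (AllPairs.head unique)))
                    ∷ Unique.map⁻ (AllPairs.tail (AllPairs.tail unique))
  ; cycle-unique    = subst Unique (sym cycle-e)
                        (All.¬Any⇒All¬ _ (proj₂ uniq×1∉ ∘ ∈-map⁺ suc) ∷ Unique.map⁻ (proj₁ uniq×1∉))
  ; avoids213       = avoids213 ∘ Contains213-⊆ (refl ∷ 0 ∷ʳ ⊆-refl) ∘ Contains213-map⁺ s≤s s≤s⁻¹
  ; cycle-avoids213 = cycle-avoids213 ∘ subst Contains213 (sym cycle≡) ∘ Contains213-⊆ (0 ∷ʳ Sublist.++⁺ʳ [ 1 ] ⊆-refl)
                    ∘ Contains213-map⁺ s≤s s≤s⁻¹ ∘ Contains213-∷-min (All.tabulate λ _ → z≤n) ∘ subst Contains213 cycle-e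
  }
  where
  open Admissible adm
  open Orbit adm using (c-<; c-closes; π-injective)
  hw he : ℕ → ℕ
  hw = nth (withSecond0 (x ∷ xs))
  he = nth (x ∷ xs)
  tailCycle : List ℕ
  tailCycle = iterate he x (suc k)
  bounded-e : All (_< suc (suc k)) (x ∷ xs)
  bounded-e = ≤-refl ∷ All.map⁻ (All.map s≤s⁻¹ (All.tail (All.tail bounded)))
  cycle-e : cycleOf (x ∷ xs) ≡ 0 ∷ tailCycle
  cycle-e = cong (iterate he 0 ∘ suc) length≡xs
  last≡1 : fold (suc x) hw (suc k) ≡ 1
  last≡1 = trans (fold-shift hw 0 (suc k)) (π-injective (c-< (s≤s z≤n) (suc (suc k))) (s≤s (s≤s z≤n)) (c-closes refl))
  1∉orbit : 1 ∉ iterate hw (hw (suc x)) k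
  1∉orbit = proj₂ (Unique-∷ʳ⁻ _
    (subst (λ y → Unique (iterate hw (hw (suc x)) k ++ [ y ])) (trans (fold-shift hw (suc x) k) last≡1)
      (subst Unique (iterate-∷ʳ hw (hw (suc x)) k)
        (AllPairs.tail (AllPairs.tail (subst Unique (cycle-withSecond0-prefix x xs length≡xs) cycle-unique))))))
  cycle≡ : cycleOf (withSecond0 (x ∷ xs)) ≡ 0 ∷ map suc tailCycle ++ [ 1 ]
  cycle≡ = cycle-withSecond0 x xs length≡xs bounded-e (s≤s z≤n) (inj₂ (1∉orbit , last≡1))
  uniq×1∉ : Unique (map suc tailCycle) × 1 ∉ map suc tailCycle
  uniq×1∉ = Unique-∷ʳ⁻ (map suc tailCycle) (AllPairs.tail (subst Unique cycle≡ cycle-unique))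

-- The enumeration

-- rotation m is 1 2 … m 0, the permutation i ↦ i + 1 modulo m + 1.
rotation : ℕ → List ℕ
rotation zero    = [ 0 ]
rotation (suc m) = withHead1 (rotation m)

rotation-∷ʳ : ∀ m → ∃[ σ ] rotation m ≡ σ ++ [ 0 ]
rotation-∷ʳ zero    = [] , refl
rotation-∷ʳ (suc m) with σ , eq ← rotation-∷ʳ m =
  1 ∷ map punchIn₁ σ , cong (1 ∷_) (trans (cong (map punchIn₁) eq) (map-++ punchIn₁ σ [ 0 ]))

rotation-admissible : ∀ m → Admissible (suc m) (rotation m)
rotation-admissible zero = record
  { length≡         = refl
  ; bounded         = s≤s z≤n ∷ []
  ; unique          = [] ∷ []
  ; cycle-unique    = [] ∷ []
  ; avoids213       = λ { (occurrence _ _ (_ ∷ʳ ())) ; (occurrence _ _ (_ ∷ ())) }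
  ; cycle-avoids213 = λ { (occurrence _ _ (_ ∷ʳ ())) ; (occurrence _ _ (_ ∷ ())) }
  }
rotation-admissible (suc m) with σ , eq ← rotation-∷ʳ m =
  subst (Admissible (suc (suc m)) ∘ withHead1) (sym eq) (withHead1-admissible σ (subst (Admissible (suc m)) eq (rotation-admissible m)))

-- For m ≥ 2, maxHeaded m lists the admissible permutations of 0, …, m with π 0 = m.
maxHeaded : ℕ → List (List ℕ)
maxHeaded zero          = []
maxHeaded (suc zero)    = []
maxHeaded (suc (suc m)) = map withLast1 (rotation m ∷ maxHeaded m) ++ map withSecond0 (maxHeaded (suc m))

admissibles : ℕ → List (List ℕ)
admissibles m = rotation m ∷ maxHeaded m

MaxHeaded : ℕ → List ℕ → Set
MaxHeaded m w = Admissible (suc m) w × nth w 0 ≡ m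

withLast1-maxHeaded : ∀ {k d} → Admissible (suc k) d → MaxHeaded (suc (suc k)) (withLast1 d)
withLast1-maxHeaded adm = withLast1-admissible adm , cong suc (Admissible.length≡ adm)

withSecond0-maxHeaded : ∀ {k e} → MaxHeaded (suc k) e → MaxHeaded (suc (suc k)) (withSecond0 e)
withSecond0-maxHeaded {e = []}     (adm , _)     = contradiction (Admissible.length≡ adm) λ ()
withSecond0-maxHeaded {e = x ∷ xs} (adm , x≡1+k) = withSecond0-admissible adm x≡1+k , cong suc x≡1+k

maxHeaded-sound-step : ∀ m → (∀ {d} → d ∈ maxHeaded m → MaxHeaded m d) →
                       (∀ {e} → e ∈ maxHeaded (suc m) → MaxHeaded (suc m) e) →
                       ∀ {w} → w ∈ maxHeaded (suc (suc m)) → MaxHeaded (suc (suc m)) w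
maxHeaded-sound-step m sound₀ sound₁ w∈ with ∈-++⁻ (map withLast1 (admissibles m)) w∈
... | inj₁ w∈₁ with d , d∈ , refl ← ∈-map⁻ withLast1 w∈₁ = withLast1-maxHeaded (adm d∈)
  where
  adm : ∀ {d} → d ∈ admissibles m → Admissible (suc m) d
  adm (here refl) = rotation-admissible m
  adm (there d∈)  = proj₁ (sound₀ d∈)
... | inj₂ w∈₂ with e , e∈ , refl ← ∈-map⁻ withSecond0 w∈₂ = withSecond0-maxHeaded (sound₁ e∈)

maxHeaded-sound : ∀ m {w} → w ∈ maxHeaded m → MaxHeaded m w
maxHeaded-sound (suc (suc m)) = maxHeaded-sound-step m (maxHeaded-sound m) (maxHeaded-sound (suc m))

admissibles-sound : ∀ m {w} → w ∈ admissibles m → Admissible (suc m) w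
admissibles-sound m (here refl) = rotation-admissible m
admissibles-sound m (there w∈)  = proj₁ (maxHeaded-sound m w∈)

head-1⇒withHead1 : ∀ {n w} → Admissible n w → nth w 0 ≡ 1 → ∃[ ρ ] w ≡ withHead1 ρ
head-1⇒withHead1 {w = _ ∷ u} adm refl =
  map pred u , cong (1 ∷_) (sym (map-map-pred (All.map (punchIn₁-pred ∘ ≢-sym) (AllPairs.head (Admissible.unique adm)))))

last-1⇒withLast1 : ∀ {k w} → Admissible (suc (suc (suc k))) w → nth w 0 ≡ suc (suc k) → nth w (suc (suc k)) ≡ 1 →
                   ∃[ d ] (w ≡ withLast1 d × length d ≡ suc k)
last-1⇒withLast1 {k} {_ ∷ u} adm refl last≡1 with initLast u
... | []       = contradiction (Admissible.length≡ adm) λ ()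
... | ys ∷ʳ′ y =
  map pred ys , cong₂ _∷_ (cong suc (sym (trans (length-map pred ys) length-ys)))
                          (cong₂ (λ zs z → zs ++ [ z ]) (sym (map-map-pred (All.map (punchIn₁-pred ∘ ≢-sym) ≢1))) y≡1) ,
  trans (length-map pred ys) length-ys
  where
  open Admissible adm
  length-ys : length ys ≡ suc k
  length-ys = suc-injective (trans (sym (length-∷ʳ ys)) (suc-injective length≡))
  y≡1 : y ≡ 1
  y≡1 = trans (sym (nth-++-length ys)) (subst (λ l → nth (ys ++ [ y ]) l ≡ 1) (sym length-ys) last≡1)
  ≢1 : All (1 ≢_) ys
  ≢1 = All.¬Any⇒All¬ ys (subst (_∉ ys) y≡1 (proj₂ (Unique-∷ʳ⁻ ys (AllPairs.tail unique))))

second-0⇒withSecond0 : ∀ {k w} → Admissible (suc (suc (suc k))) w → nth w 0 ≡ suc (suc k) → nth w 1 ≡ 0 →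
                       ∃[ xs ] (w ≡ withSecond0 (suc k ∷ xs) × length xs ≡ suc k)
second-0⇒withSecond0 {k} {_ ∷ _ ∷ r} adm refl refl =
  map pred r , cong ((suc (suc k) ∷_) ∘ (0 ∷_)) (sym (map-map-pred (All.map (λ 0≢x → suc-pred _ ⦃ ≢-nonZero (≢-sym 0≢x) ⦄) ≢0))) ,
  trans (length-map pred r) (suc-injective (suc-injective (Admissible.length≡ adm)))
  where
  ≢0 : All (0 ≢_) r
  ≢0 = AllPairs.head (AllPairs.tail (Admissible.unique adm))

admissible₁⇒rotation : ∀ {w} → Admissible 1 w → w ≡ rotation 0
admissible₁⇒rotation {[]}         adm = contradiction (Admissible.length≡ adm) λ ()
admissible₁⇒rotation {_ ∷ _ ∷ _}  adm = contradiction (Admissible.length≡ adm) λ ()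
admissible₁⇒rotation {x ∷ []}     adm with All.head (Admissible.bounded adm)
... | s≤s z≤n = refl

admissible₂⇒rotation : ∀ {w} → Admissible 2 w → w ≡ rotation 1
admissible₂⇒rotation {[]}            adm = contradiction (Admissible.length≡ adm) λ ()
admissible₂⇒rotation {_ ∷ []}        adm = contradiction (Admissible.length≡ adm) λ ()
admissible₂⇒rotation {_ ∷ _ ∷ _ ∷ _} adm = contradiction (Admissible.length≡ adm) λ ()
admissible₂⇒rotation {a ∷ b ∷ []}    adm with Admissible.bounded adm | Admissible.unique adm | Admissible.cycle-unique adm
... | s≤s z≤n ∷ _                        | _                  | (0≢0 ∷ []) ∷ _ = contradiction refl 0≢0
... | s≤s (s≤s z≤n) ∷ s≤s z≤n ∷ []       | _                  | _              = refl
... | s≤s (s≤s z≤n) ∷ s≤s (s≤s z≤n) ∷ [] | (1≢1 ∷ []) ∷ _     | _              = contradiction refl 1≢1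

-- The cycle would close after three steps: 0 ↦ 1 ↦ m ↦ 0, where m is the largest label.
withHead1-maxHeaded-last≢0 : ∀ m {ρ} → ρ ∈ maxHeaded (suc m) → Admissible (suc (suc (suc m))) (withHead1 ρ) →
                             nth (withHead1 ρ) (suc (suc m)) ≢ 0
withHead1-maxHeaded-last≢0 (suc m) {ρ} ρ∈ adm πm≡0 =
  contradiction (Orbit.c-injective adm (s≤s (s≤s (s≤s (s≤s z≤n)))) (s≤s z≤n) (trans (cong (nth (withHead1 ρ)) π1≡m) πm≡0))
                λ ()
  where
  π1≡m : nth (map punchIn₁ ρ) 0 ≡ suc (suc (suc m))
  π1≡m = trans (nth-map-punchIn₁ ρ 0) (cong punchIn₁ (proj₂ (maxHeaded-sound (suc (suc m)) ρ∈)))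

admissibles-complete-step : ∀ m → (∀ {d} → Admissible (suc m) d → d ∈ admissibles m) →
                            (∀ {e} → Admissible (suc (suc m)) e → e ∈ admissibles (suc m)) →
                            ∀ {w} → Admissible (suc (suc (suc m))) w → w ∈ admissibles (suc (suc m))
admissibles-complete-step m complete₀ complete₁ adm with Classification.classify adm (s≤s (s≤s z≤n))
... | head-1 π0≡1 πm≡0 with ρ , refl ← head-1⇒withHead1 adm π0≡1
      with complete₁ (withHead1-admissible⁻ ρ (suc-injective (trans (cong suc (sym (length-map punchIn₁ ρ))) (Admissible.length≡ adm)))
                                              adm)
...   | here refl = here refl
...   | there ρ∈  = contradiction πm≡0 (withHead1-maxHeaded-last≢0 m ρ∈ adm)
admissibles-complete-step m complete₀ complete₁ adm | head-max∧last-1 π0≡m πm≡1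
      with d , refl , length-d ← last-1⇒withLast1 adm π0≡m πm≡1 =
  there (∈-++⁺ˡ (∈-map⁺ withLast1 (complete₀ (withLast1-admissible⁻ d length-d adm))))
admissibles-complete-step m complete₀ complete₁ adm | head-max∧second-0 π0≡m π1≡0 πm≢1
      with xs , refl , length-xs ← second-0⇒withSecond0 adm π0≡m π1≡0
      with complete₁ (withSecond0-admissible⁻ (suc m) xs length-xs refl adm)
...   | there e∈  = there (∈-++⁺ʳ (map withLast1 (admissibles m)) (∈-map⁺ withSecond0 e∈))
...   | here e≡rot with refl ← suc-injective (∷-injectiveˡ e≡rot) with refl ← ∷-injectiveʳ e≡rot = contradiction refl πm≢1

admissibles-complete : ∀ m {w} → Admissible (suc m) w → w ∈ admissibles m
admissibles-complete zero          adm = here (admissible₁⇒rotation adm)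
admissibles-complete (suc zero)    adm = here (admissible₂⇒rotation adm)
admissibles-complete (suc (suc m)) adm = admissibles-complete-step m (admissibles-complete m) (admissibles-complete (suc m)) adm

withLast1-injective : ∀ {d d′} → withLast1 d ≡ withLast1 d′ → d ≡ d′
withLast1-injective {d} {d′} eq =
  map-injective punchIn₁-injective (∷ʳ-injectiveˡ (map punchIn₁ d) (map punchIn₁ d′) (∷-injectiveʳ eq))

withSecond0-injective : ∀ {e e′} → withSecond0 e ≡ withSecond0 e′ → e ≡ e′
withSecond0-injective {[]}     {[]}     _  = refl
withSecond0-injective {x ∷ xs} {y ∷ ys} eq =
  cong₂ _∷_ (suc-injective (∷-injectiveˡ eq)) (map-injective suc-injective (∷-injectiveʳ (∷-injectiveʳ eq)))

-- The second entry is 0 after withSecond0, but punchIn₁ (d 0) ≠ 0 after withLast1 d.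
withLast1≢withSecond0 : ∀ {m d e} → Admissible (suc (suc m)) d → withLast1 d ≢ withSecond0 e
withLast1≢withSecond0 {m} {d₀ ∷ ds} {x ∷ xs} adm eq =
  Orbit.π0≢0 adm (s≤s (s≤s z≤n)) (punchIn₁-injective (∷-injectiveˡ (∷-injectiveʳ eq)))

rotation∉maxHeaded : ∀ m → rotation m ∉ maxHeaded m
rotation∉maxHeaded zero          ()
rotation∉maxHeaded (suc zero)    ()
rotation∉maxHeaded (suc (suc m)) rot∈ = contradiction (proj₂ (maxHeaded-sound (suc (suc m)) rot∈)) λ ()

withLast1-withSecond0-disjoint : ∀ m {v} → v ∈ map withLast1 (admissibles m) → v ∉ map withSecond0 (maxHeaded (suc m))
withLast1-withSecond0-disjoint (suc m) v∈₁ v∈₂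
  with d , d∈ , refl ← ∈-map⁻ withLast1 v∈₁ | e , _ , eq ← ∈-map⁻ withSecond0 v∈₂ =
  withLast1≢withSecond0 (admissibles-sound (suc m) d∈) eq

mutual
  admissibles-unique : ∀ m → Unique (admissibles m)
  admissibles-unique m = All.¬Any⇒All¬ _ (rotation∉maxHeaded m) ∷ maxHeaded-unique m

  maxHeaded-unique : ∀ m → Unique (maxHeaded m)
  maxHeaded-unique zero          = []
  maxHeaded-unique (suc zero)    = []
  maxHeaded-unique (suc (suc m)) =
    Unique.++⁺ (Unique.map⁺ withLast1-injective (admissibles-unique m)) (Unique.map⁺ withSecond0-injective (maxHeaded-unique (suc m)))
               (λ (v∈₁ , v∈₂) → withLast1-withSecond0-disjoint m v∈₁ v∈₂)

length-admissibles : ∀ m → length (admissibles m) ≡ fib (suc m)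
length-admissibles zero          = refl
length-admissibles (suc zero)    = refl
length-admissibles (suc (suc m)) = begin
  suc (length (map withLast1 (admissibles m) ++ map withSecond0 (maxHeaded (suc m))))
    ≡⟨ cong suc (trans (length-++ (map withLast1 (admissibles m)))
                       (cong₂ _+_ (length-map _ (admissibles m)) (length-map _ (maxHeaded (suc m))))) ⟩
  suc (length (admissibles m) + length (maxHeaded (suc m)))
    ≡⟨ sym (+-suc (length (admissibles m)) (length (maxHeaded (suc m)))) ⟩
  length (admissibles m) + length (admissibles (suc m))
    ≡⟨ cong₂ _+_ (length-admissibles m) (length-admissibles (suc m)) ⟩
  fib (suc m) + fib (suc (suc m))
    ≡⟨ +-comm (fib (suc m)) _ ⟩
  fib (suc (suc (suc m))) ∎
  where open ≡-Reasoning

toℕs : ∀ {n k} → Vec (Fin n) k → List ℕ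
toℕs v = map toℕ (toList v)

toℕs-injective : ∀ {n k} (v v′ : Vec (Fin n) k) → toℕs v ≡ toℕs v′ → v ≡ v′
toℕs-injective []ᵛ       []ᵛ         _  = refl
toℕs-injective (x ∷ᵛ v) (x′ ∷ᵛ v′) eq =
  cong₂ _∷ᵛ_ (toℕ-injective (∷-injectiveˡ eq)) (toℕs-injective v v′ (∷-injectiveʳ eq))

length-toℕs : ∀ {n k} (v : Vec (Fin n) k) → length (toℕs v) ≡ k
length-toℕs v = trans (length-map toℕ (toList v)) (Vec.length-toList v)

toℕs-bounded : ∀ {n k} (v : Vec (Fin n) k) → All (_< n) (toℕs v)
toℕs-bounded v = All.map⁺ (All.tabulate λ {i} _ → toℕ<n i)

nth-toℕs : ∀ {n k} (v : Vec (Fin n) k) i → nth (toℕs v) (toℕ i) ≡ toℕ (lookup v i)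
nth-toℕs (x ∷ᵛ v) fzero    = refl
nth-toℕs (x ∷ᵛ v) (fsuc i) = nth-toℕs v i

toℕs-surjective : ∀ {n} k {w} → length w ≡ k → All (_< n) w → ∃[ v ] (toℕs {n} {k} v ≡ w)
toℕs-surjective zero    {[]}    _       []             = []ᵛ , refl
toℕs-surjective (suc k) {x ∷ w} length≡ (x<n ∷ bounded) with v , refl ← toℕs-surjective k (suc-injective length≡) bounded =
  fromℕ< x<n ∷ᵛ v , cong (_∷ toℕs v) (toℕ-fromℕ< x<n)

toℕs-orbit : ∀ {n} (v : Vec (Fin n) n) k x → map toℕ (orbit v k x) ≡ iterate (nth (oneLine v)) (toℕ x) k
toℕs-orbit v zero    x = refl
toℕs-orbit v (suc k) x =
  cong (toℕ x ∷_) (trans (toℕs-orbit v k (lookup v x)) (cong (λ y → iterate (nth (oneLine v)) y k) (sym (nth-toℕs v x))))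

cycleNotation≡cycleOf : ∀ {n} (v : Vec (Fin n) n) → cycleNotation v ≡ cycleOf (oneLine v)
cycleNotation≡cycleOf {zero}  []ᵛ = refl
cycleNotation≡cycleOf {suc m} v   = trans (toℕs-orbit v (suc m) fzero) (cong (iterate (nth (oneLine v)) 0) (sym (length-toℕs v)))

admissible⇔ : ∀ {n} (v : Vec (Fin n) n) →
              T (isCyclic v ∧ avoids p213 (oneLine v) ∧ avoids p213 (cycleNotation v)) ⇔ Admissible n (oneLine v)
admissible⇔ {n} v = mk⇔ decode encode
  where
  open Equivalence
  cycle≡ : cycleNotation v ≡ cycleOf (oneLine v)
  cycle≡ = cycleNotation≡cycleOf v
  decode : T (isCyclic v ∧ avoids p213 (oneLine v) ∧ avoids p213 (cycleNotation v)) → Admissible n (oneLine v)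
  decode holds =
    let cyclic , avoid = T-∧ .to holds ; perm , cycle-distinct = T-∧ .to cyclic ; avoid₁ , avoid₂ = T-∧ .to avoid
    in record
      { length≡         = length-toℕs v
      ; bounded         = toℕs-bounded v
      ; unique          = distinct⇔Unique _ .to perm
      ; cycle-unique    = subst Unique cycle≡ (distinct⇔Unique _ .to cycle-distinct)
      ; avoids213       = avoids213⇔ _ .to avoid₁
      ; cycle-avoids213 = subst (¬_ ∘ Contains213) cycle≡ (avoids213⇔ _ .to avoid₂)
      }
  encode : Admissible n (oneLine v) → T (isCyclic v ∧ avoids p213 (oneLine v) ∧ avoids p213 (cycleNotation v))
  encode adm =
    T-∧ .from ( T-∧ .from (distinct⇔Unique _ .from unique , distinct⇔Unique _ .from (subst Unique (sym cycle≡) cycle-unique))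
              , T-∧ .from (avoids213⇔ _ .from avoids213 ,
                           avoids213⇔ _ .from (subst (¬_ ∘ Contains213) (sym cycle≡) cycle-avoids213)))
    where open Admissible adm

concatMap-map≡cartesianProductWith : ∀ {A B C : Set} (f : A → B → C) xs ys →
                                     concatMap (λ x → map (f x) ys) xs ≡ cartesianProductWith f xs ys
concatMap-map≡cartesianProductWith f []       ys = refl
concatMap-map≡cartesianProductWith f (x ∷ xs) ys = cong (map (f x) ys ++_) (concatMap-map≡cartesianProductWith f xs ys)

∈-allVecs : ∀ {n} k (v : Vec (Fin n) k) → v ∈ allVecs k n
∈-allVecs zero    []ᵛ       = here refl
∈-allVecs {n} (suc k) (x ∷ᵛ v) = subst (_ ∈_) (sym (concatMap-map≡cartesianProductWith _∷ᵛ_ (allFin n) (allVecs k n)))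
  (∈-cartesianProductWith⁺ _∷ᵛ_ (∈-allFin x) (∈-allVecs k v))

allVecs-unique : ∀ k n → Unique (allVecs k n)
allVecs-unique zero    n = [] ∷ []
allVecs-unique (suc k) n = subst Unique (sym (concatMap-map≡cartesianProductWith _∷ᵛ_ (allFin n) (allVecs k n)))
  (Unique.cartesianProductWith⁺ _∷ᵛ_ Vec.∷-injective (Unique.allFin⁺ n) (allVecs-unique k n))

module _ (n : ℕ) where

  admissible? : ∀ v → Dec (T (isCyclic {n} v ∧ avoids p213 (oneLine v) ∧ avoids p213 (cycleNotation v)))
  admissible? v = T? (isCyclic v ∧ avoids p213 (oneLine v) ∧ avoids p213 (cycleNotation v))

  ∈-oneLine-𝒜⇔ : ∀ {w} → w ∈ map oneLine (𝒜 n p213 p213) ⇔ Admissible n w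
  ∈-oneLine-𝒜⇔ = mk⇔
    (λ w∈ → let v , v∈ , w≡ = ∈-map⁻ oneLine w∈
            in subst (Admissible n) (sym w≡) (Equivalence.to (admissible⇔ v) (proj₂ (∈-filter⁻ admissible? {xs = allVecs n n} v∈))))
    (λ adm → let open Admissible adm; v , v≡ = toℕs-surjective n length≡ bounded
             in subst (_∈ _) v≡ (∈-map⁺ oneLine (∈-filter⁺ admissible? (∈-allVecs n v)
                                   (Equivalence.from (admissible⇔ v) (subst (Admissible n) (sym v≡) adm)))))

  oneLine-𝒜-unique : Unique (map oneLine (𝒜 n p213 p213))
  oneLine-𝒜-unique = Unique.map⁺ (toℕs-injective _ _) (Unique.filter⁺ admissible? (allVecs-unique n n))

theorem3p13 : (n : ℕ) → n ≥ 1 → a n p213 p213 ≡ fib n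
theorem3p13 (suc m) _ = begin
  length (𝒜 (suc m) p213 p213)
    ≡⟨ sym (length-map oneLine (𝒜 (suc m) p213 p213)) ⟩
  length (map oneLine (𝒜 (suc m) p213 p213))
    ≡⟨ Unique⇒length≡ (oneLine-𝒜-unique (suc m)) (admissibles-unique m) same-members ⟩
  length (admissibles m)
    ≡⟨ length-admissibles m ⟩
  fib (suc m) ∎
  where
  open ≡-Reasoning
  same-members : ∀ {w} → w ∈ map oneLine (𝒜 (suc m) p213 p213) ⇔ w ∈ admissibles m
  same-members = mk⇔ (admissibles-complete m ∘ Equivalence.to (∈-oneLine-𝒜⇔ (suc m)))
                     (Equivalence.from (∈-oneLine-𝒜⇔ (suc m)) ∘ admissibles-sound m)
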